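{- Let $n,k$ be positive integers and let $p=\left(\left\lceil\frac{n-1}{2k}\right\rceil-1\right)k+1$. Then $$\mathit{gn}(K(2n+k,n))\le 1+\sum_{i=p}^{p+H(n,k)}\binom{n}{i}\binom{n+k}{n-i},$$ where $$H(n,k)=\begin{cases}\max\{(n\bmod k)+k-2,\,0\}, & \text{if } 0\le n\bmod k\le 1,\\ (n\bmod k)-2, & \text{if } 2\le n\bmod k\le k-1.\end{cases}$$
   Context: For positive integers $n,k$, the Kneser graph $K(2n+k,n)$ has as vertex set all $n$-element subsets of $\{1,\ldots,2n+k\}$, two vertices $u,v$ being adjacent iff $u\cap v=\emptyset$. For vertices $u,v$, $I[u,v]$ is the set of all vertices lying on some shortest $u$–$v$ path; for $W\subseteq V(G)$, $I[W]=\bigcup_{u,v\in W}I[u,v]$. $W$ is a geodetic set if $I[W]=V(G)$, and the geodetic number $\mathit{gn}(G)$ is the minimum size of a geodetic set. Binomial coefficients $\binom{a}{b}$ are taken to be $0$ when $b<0$ or $b>a$. -}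

module Defs where

open import Data.Nat as ℕ using (ℕ; zero; suc; _+_; _*_; _∸_; _≤_; _≤ᵇ_; _/_; _%_; NonZero)
open import Data.Nat.Combinatorics using (_C_)
open import Data.Nat.Properties using (m*n≢0)
open import Data.Integer as ℤ using (ℤ; +_; -[1+_])
open import Data.Bool using (if_then_else_)
open import Data.Fin.Subset using (Subset; ∣_∣; _∩_) renaming (⊥ to ∅)
open import Data.Product using (Σ; ∃; ∃-syntax; _×_; _,_)
open import Data.Sum using (_⊎_)
open import Data.List using (List; length)
open import Data.List.Membership.Propositional using (_∈_)
open import Relation.Binary.PropositionalEquality using (_≡_)

data Walk {V : Set} (A : V → V → Set) : V → V → ℕ → Set where
  stop : ∀ {x} → Walk A x x 0
  step : ∀ {x y z l} → A x y → Walk A y z l → Walk A x z (suc l)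

data OnWalk {V : Set} {A : V → V → Set} (w : V) :
            ∀ {x y l} → Walk A x y l → Set where
  start : ∀ {y l} (p : Walk A w y l) → OnWalk w p
  later : ∀ {x y z l} (a : A x y) {p : Walk A y z l} →
          OnWalk w p → OnWalk w (step a p)

Shortest : {V : Set} (A : V → V → Set) (u v : V) (l : ℕ) → Set
Shortest A u v l = ∀ l' → Walk A u v l' → l ≤ l'

InInterval : {V : Set} (A : V → V → Set) (u v w : V) → Set
InInterval A u v w =
  ∃[ l ] Σ (Walk A u v l) (λ p → Shortest A u v l × OnWalk w p)

Geodetic : {V : Set} (A : V → V → Set) (W : List V) → Set
Geodetic A W = ∀ w → ∃[ u ] ∃[ v ] (u ∈ W × v ∈ W × InInterval A u v w)

KVertex : (n k : ℕ) → Set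
KVertex n k = Σ (Subset (2 * n + k)) (λ s → ∣ s ∣ ≡ n)

KAdj : (n k : ℕ) → KVertex n k → KVertex n k → Set
KAdj n k (s , _) (t , _) = s ∩ t ≡ ∅

binomℤ : ℕ → ℤ → ℕ
binomℤ a (+ b)    = a C b
binomℤ a -[1+ _ ] = 0

ceilDiv : (a b : ℕ) .{{_ : NonZero b}} → ℕ
ceilDiv a b = (a + (b ∸ 1)) / b

-- p = (⌈(n-1)/(2k)⌉ - 1) k + 1   (as an integer; may be ≤ 0)
pVal : (n k : ℕ) .{{_ : NonZero k}} → ℤ
pVal n k = ((+ ceilDiv (n ∸ 1) (2 * k) {{nz}}) ℤ.- + 1) ℤ.* (+ k) ℤ.+ + 1
  where
  nz : NonZero (2 * k)
  nz = m*n≢0 2 k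

H : (n k : ℕ) .{{_ : NonZero k}} → ℕ
H n k = if (n % k) ≤ᵇ 1 then ((n % k) + k) ∸ 2 else (n % k) ∸ 2

sumTo : ℕ → (ℕ → ℕ) → ℕ
sumTo zero    f = f 0
sumTo (suc h) f = sumTo h f + f (suc h)

bound : (n k : ℕ) .{{_ : NonZero k}} → ℕ
bound n k = 1 + sumTo (H n k) (λ j →
  let i = pVal n k ℤ.+ + j in
  binomℤ n i * binomℤ (n + k) (+ n ℤ.- i))

-- Write the graph as K(2N + K, N). The distance between two vertices depends only on the
-- number s of elements they share: it is the least l such that either l = 2t and N ≤ s + tK,
-- or l = 2t + 1 and s ≤ tK. Fix a vertex u₀. If |u₀ ∩ w| lies outside the range [p, p + H],
-- then w has a neighbour one step farther from u₀, so every shortest u₀–w path extends to a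
-- shortest path from u₀ to a vertex meeting u₀ in a number of elements from [p, p + H].
-- Hence u₀ together with all such vertices is geodetic, and there are
-- Σ_{i=p}^{p+H} C(N, i) C(N + K, N − i) of them: choose i elements of u₀ and N − i elements
-- of its complement.

module Submission where

open import Defs
open import Data.Nat using (ℕ; suc; _≤_)
open import Data.List using (List; length)
open import Data.Product using (Σ; _×_)

open import Data.Bool using (if_then_else_)
open import Data.Empty using (⊥-elim)
open import Data.Fin.Subset using (Subset; ∣_∣; _∩_; ∁; inside; outside) renaming (⊥ to ∅)
open import Data.Fin.Subset.Properties using (∩-comm; ∩-idem; ∣p∩q∣≤∣p∣; ∣p∩q∣≤∣q∣; ∣p∣≤n; ∣∁p∣≡n∸∣p∣)
open import Data.Integer as ℤ using (ℤ; +_; -[1+_])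
open import Data.Integer.Properties using (pos-*; [+m]-[+n]≡m⊖n; ⊖-≥)
open import Data.Integer.Tactic.RingSolver using () renaming (solve-∀ to ℤ-solve-∀)
open import Data.List as List using ([_]; map; _++_; mapMaybe)
open import Data.List.Properties using (length-map; length-++; length-mapMaybe)
open import Data.List.Membership.Propositional using (_∈_)
open import Data.List.Membership.Propositional.Properties using (∈-map⁺; ∈-++⁺ˡ; ∈-++⁺ʳ)
open import Data.List.Relation.Unary.Any as Any using (here; there)
import Data.List.Relation.Unary.Any.Properties as Any
open import Data.Maybe using (Maybe; just; nothing)
import Data.Maybe.Relation.Unary.Any as Maybe
open import Data.Nat as ℕ using (zero; z≤n; s≤s; s≤s⁻¹; _+_; _*_; _∸_; _<_; _⊓_; _≤ᵇ_; _%_; NonZero)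
open import Data.Nat.Combinatorics using (_C_; nCk+nC[k+1]≡[n+1]C[k+1]; k>n⇒nCk≡0)
open import Data.Nat.DivMod
  using (_/_; /-congˡ; +-distrib-/-∣ʳ; m<n⇒m/n≡0; m*n/n≡m; [m+kn]%n≡m%n; m<n⇒m%n≡m; n%n≡0)
open import Data.Nat.Divisibility using (n∣m*n)
open import Data.Nat.Properties
open import Algebra.Properties.CommutativeSemigroup +-commutativeSemigroup
  using () renaming (interchange to +-interchange)
open import Data.Nat.Tactic.RingSolver using (solve-∀)
open import Data.Product as Prod using (∃; ∃-syntax; _,_; proj₁; proj₂)
open import Data.Sum using (_⊎_; inj₁; inj₂)
open import Data.Vec using ([]; _∷_)
open import Data.Vec.Properties using (∷-injectiveʳ)
open import Function using (id; _∘_)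
open import Relation.Binary.PropositionalEquality
  using (_≡_; refl; sym; trans; cong; cong₂; subst; subst₂; module ≡-Reasoning)
open import Relation.Nullary using (¬_; yes; no; contradiction)
import Relation.Nullary.Decidable as Dec
open import Relation.Unary using (Decidable)

private
  variable
    m : ℕ

∣p∩q∣+∣p∩∁q∣≡∣p∣ : (p q : Subset m) → ∣ p ∩ q ∣ + ∣ p ∩ ∁ q ∣ ≡ ∣ p ∣
∣p∩q∣+∣p∩∁q∣≡∣p∣ []            []            = refl
∣p∩q∣+∣p∩∁q∣≡∣p∣ (inside ∷ p)  (inside ∷ q)  = cong suc (∣p∩q∣+∣p∩∁q∣≡∣p∣ p q)
∣p∩q∣+∣p∩∁q∣≡∣p∣ (inside ∷ p)  (outside ∷ q) = trans (+-suc _ _) (cong suc (∣p∩q∣+∣p∩∁q∣≡∣p∣ p q))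
∣p∩q∣+∣p∩∁q∣≡∣p∣ (outside ∷ p) (_ ∷ q)       = ∣p∩q∣+∣p∩∁q∣≡∣p∣ p q

∣p∩q∣+∣∁p∩q∣≡∣q∣ : (p q : Subset m) → ∣ p ∩ q ∣ + ∣ ∁ p ∩ q ∣ ≡ ∣ q ∣
∣p∩q∣+∣∁p∩q∣≡∣q∣ p q =
  subst₂ (λ a b → ∣ a ∣ + ∣ b ∣ ≡ ∣ q ∣) (∩-comm q p) (∩-comm q (∁ p)) (∣p∩q∣+∣p∩∁q∣≡∣p∣ q p)

∣p∣+∣∁p∣≡n : (p : Subset m) → ∣ p ∣ + ∣ ∁ p ∣ ≡ m
∣p∣+∣∁p∣≡n p = trans (cong (∣ p ∣ ℕ.+_) (∣∁p∣≡n∸∣p∣ p)) (m+[n∸m]≡n (∣p∣≤n p))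

∣p∣≤∣p∩q∣⇒∣q∣≤∣p∩q∣⇒p≡q : (p q : Subset m) → ∣ p ∣ ≤ ∣ p ∩ q ∣ → ∣ q ∣ ≤ ∣ p ∩ q ∣ → p ≡ q
∣p∣≤∣p∩q∣⇒∣q∣≤∣p∩q∣⇒p≡q []            []            _        _        = refl
∣p∣≤∣p∩q∣⇒∣q∣≤∣p∩q∣⇒p≡q (inside ∷ p)  (inside ∷ q)  (s≤s hp) (s≤s hq) =
  cong (inside ∷_) (∣p∣≤∣p∩q∣⇒∣q∣≤∣p∩q∣⇒p≡q p q hp hq)
∣p∣≤∣p∩q∣⇒∣q∣≤∣p∩q∣⇒p≡q (inside ∷ p)  (outside ∷ q) hp       _        = ⊥-elim (<⇒≱ (s≤s (∣p∩q∣≤∣p∣ p q)) hp)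
∣p∣≤∣p∩q∣⇒∣q∣≤∣p∩q∣⇒p≡q (outside ∷ p) (inside ∷ q)  _        hq       = ⊥-elim (<⇒≱ (s≤s (∣p∩q∣≤∣q∣ p q)) hq)
∣p∣≤∣p∩q∣⇒∣q∣≤∣p∩q∣⇒p≡q (outside ∷ p) (outside ∷ q) hp       hq       =
  cong (outside ∷_) (∣p∣≤∣p∩q∣⇒∣q∣≤∣p∩q∣⇒p≡q p q hp hq)

p∩q≡∅⇒∣p∩r∣+∣q∩r∣≤∣r∣ : (p q r : Subset m) → p ∩ q ≡ ∅ → ∣ p ∩ r ∣ + ∣ q ∩ r ∣ ≤ ∣ r ∣
p∩q≡∅⇒∣p∩r∣+∣q∩r∣≤∣r∣ []            []            []            _ = z≤n
p∩q≡∅⇒∣p∩r∣+∣q∩r∣≤∣r∣ (inside ∷ p)  (outside ∷ q) (inside ∷ r)  e =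
  s≤s (p∩q≡∅⇒∣p∩r∣+∣q∩r∣≤∣r∣ p q r (∷-injectiveʳ e))
p∩q≡∅⇒∣p∩r∣+∣q∩r∣≤∣r∣ (outside ∷ p) (inside ∷ q)  (inside ∷ r)  e =
  subst (_≤ suc ∣ r ∣) (sym (+-suc _ _)) (s≤s (p∩q≡∅⇒∣p∩r∣+∣q∩r∣≤∣r∣ p q r (∷-injectiveʳ e)))
p∩q≡∅⇒∣p∩r∣+∣q∩r∣≤∣r∣ (outside ∷ p) (outside ∷ q) (inside ∷ r)  e =
  m≤n⇒m≤1+n (p∩q≡∅⇒∣p∩r∣+∣q∩r∣≤∣r∣ p q r (∷-injectiveʳ e))
p∩q≡∅⇒∣p∩r∣+∣q∩r∣≤∣r∣ (inside ∷ p)  (outside ∷ q) (outside ∷ r) e = p∩q≡∅⇒∣p∩r∣+∣q∩r∣≤∣r∣ p q r (∷-injectiveʳ e)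
p∩q≡∅⇒∣p∩r∣+∣q∩r∣≤∣r∣ (outside ∷ p) (inside ∷ q)  (outside ∷ r) e = p∩q≡∅⇒∣p∩r∣+∣q∩r∣≤∣r∣ p q r (∷-injectiveʳ e)
p∩q≡∅⇒∣p∩r∣+∣q∩r∣≤∣r∣ (outside ∷ p) (outside ∷ q) (outside ∷ r) e = p∩q≡∅⇒∣p∩r∣+∣q∩r∣≤∣r∣ p q r (∷-injectiveʳ e)

p∩q≡∅⇒∣p∣+∣q∣≤∣p∩r∣+∣q∩r∣+∣∁r∣ : (p q r : Subset m) → p ∩ q ≡ ∅ →
  ∣ p ∣ + ∣ q ∣ ≤ ∣ p ∩ r ∣ + ∣ q ∩ r ∣ + ∣ ∁ r ∣
p∩q≡∅⇒∣p∣+∣q∣≤∣p∩r∣+∣q∩r∣+∣∁r∣ p q r p∩q≡∅ = begin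
  ∣ p ∣ + ∣ q ∣
    ≡⟨ sym (cong₂ _+_ (∣p∩q∣+∣p∩∁q∣≡∣p∣ p r) (∣p∩q∣+∣p∩∁q∣≡∣p∣ q r)) ⟩
  (∣ p ∩ r ∣ + ∣ p ∩ ∁ r ∣) + (∣ q ∩ r ∣ + ∣ q ∩ ∁ r ∣)
    ≡⟨ +-interchange (∣ p ∩ r ∣) (∣ p ∩ ∁ r ∣) (∣ q ∩ r ∣) (∣ q ∩ ∁ r ∣) ⟩
  (∣ p ∩ r ∣ + ∣ q ∩ r ∣) + (∣ p ∩ ∁ r ∣ + ∣ q ∩ ∁ r ∣)
    ≤⟨ +-monoʳ-≤ (∣ p ∩ r ∣ + ∣ q ∩ r ∣) (p∩q≡∅⇒∣p∩r∣+∣q∩r∣≤∣r∣ p q (∁ r) p∩q≡∅) ⟩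
  ∣ p ∩ r ∣ + ∣ q ∩ r ∣ + ∣ ∁ r ∣
    ∎
  where open ≤-Reasoning

subset-of-size : ∀ m {j} → j ≤ m → Σ (Subset m) (λ S → ∣ S ∣ ≡ j)
subset-of-size zero    z≤n             = [] , refl
subset-of-size (suc m) {zero}  _       = Prod.map (outside ∷_) id (subset-of-size m z≤n)
subset-of-size (suc m) {suc j} (s≤s h) = Prod.map (inside ∷_) (cong suc) (subset-of-size m h)

subset-avoiding : (x u : Subset m) {a b : ℕ} → a ≤ ∣ u ∩ ∁ x ∣ → b ≤ ∣ ∁ u ∩ ∁ x ∣ →
  ∃[ S ] (x ∩ S ≡ ∅ × ∣ S ∣ ≡ a + b × ∣ u ∩ S ∣ ≡ a)
subset-avoiding []            []                        z≤n      z≤n      = [] , refl , refl , refl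
subset-avoiding (inside ∷ x)  (inside ∷ u)              ha       hb       =
  Prod.map (outside ∷_) (Prod.map₁ (cong (outside ∷_))) (subset-avoiding x u ha hb)
subset-avoiding (inside ∷ x)  (outside ∷ u)             ha       hb       =
  Prod.map (outside ∷_) (Prod.map₁ (cong (outside ∷_))) (subset-avoiding x u ha hb)
subset-avoiding (outside ∷ x) (inside ∷ u)  {zero}      _        hb       =
  Prod.map (outside ∷_) (Prod.map₁ (cong (outside ∷_))) (subset-avoiding x u z≤n hb)
subset-avoiding (outside ∷ x) (inside ∷ u)  {suc a}     (s≤s ha) hb       =
  Prod.map (inside ∷_) (Prod.map (cong (outside ∷_)) (Prod.map (cong suc) (cong suc)))
    (subset-avoiding x u ha hb)
subset-avoiding (outside ∷ x) (outside ∷ u) {b = zero}  ha       _        =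
  Prod.map (outside ∷_) (Prod.map₁ (cong (outside ∷_))) (subset-avoiding x u ha z≤n)
subset-avoiding (outside ∷ x) (outside ∷ u) {a} {suc b} ha       (s≤s hb) =
  Prod.map (inside ∷_) (Prod.map (cong (outside ∷_)) (Prod.map₁ (λ e → trans (cong suc e) (sym (+-suc a b)))))
    (subset-avoiding x u ha hb)

subsetsMeeting : Subset m → ℕ → ℕ → List (Subset m)
subsetsMeeting []            zero    zero    = [ [] ]
subsetsMeeting []            zero    (suc r) = List.[]
subsetsMeeting []            (suc i) r       = List.[]
subsetsMeeting (inside ∷ u)  zero    r       = map (outside ∷_) (subsetsMeeting u zero r)
subsetsMeeting (inside ∷ u)  (suc i) r       =
  map (outside ∷_) (subsetsMeeting u (suc i) r) ++ map (inside ∷_) (subsetsMeeting u i r)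
subsetsMeeting (outside ∷ u) i       zero    = map (outside ∷_) (subsetsMeeting u i zero)
subsetsMeeting (outside ∷ u) i       (suc r) =
  map (outside ∷_) (subsetsMeeting u i (suc r)) ++ map (inside ∷_) (subsetsMeeting u i r)

∈-subsetsMeeting : (u v : Subset m) → v ∈ subsetsMeeting u ∣ u ∩ v ∣ ∣ ∁ u ∩ v ∣
∈-subsetsMeeting []            []            = here refl
∈-subsetsMeeting (inside ∷ u)  (outside ∷ v) with ∣ u ∩ v ∣ | ∈-subsetsMeeting u v
... | zero  | v∈ = ∈-map⁺ (outside ∷_) v∈
... | suc _ | v∈ = ∈-++⁺ˡ (∈-map⁺ (outside ∷_) v∈)
∈-subsetsMeeting (inside ∷ u)  (inside ∷ v)  = ∈-++⁺ʳ _ (∈-map⁺ (inside ∷_) (∈-subsetsMeeting u v))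
∈-subsetsMeeting (outside ∷ u) (outside ∷ v) with ∣ ∁ u ∩ v ∣ | ∈-subsetsMeeting u v
... | zero  | v∈ = ∈-map⁺ (outside ∷_) v∈
... | suc _ | v∈ = ∈-++⁺ˡ (∈-map⁺ (outside ∷_) v∈)
∈-subsetsMeeting (outside ∷ u) (inside ∷ v)  = ∈-++⁺ʳ _ (∈-map⁺ (inside ∷_) (∈-subsetsMeeting u v))

length-map-++-map : {A B C : Set} {f : A → C} {g : B → C} (xs : List A) (ys : List B) →
  length (map f xs ++ map g ys) ≡ length xs + length ys
length-map-++-map {f = f} {g} xs ys =
  trans (length-++ (map f xs)) (cong₂ _+_ (length-map f xs) (length-map g ys))

length-subsetsMeeting : (u : Subset m) (i r : ℕ) →
  length (subsetsMeeting u i r) ≡ (∣ u ∣ C i) * (∣ ∁ u ∣ C r)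
length-subsetsMeeting []            zero    zero    = refl
length-subsetsMeeting []            zero    (suc r) = refl
length-subsetsMeeting []            (suc i) r       = refl
length-subsetsMeeting (inside ∷ u)  zero    r       =
  trans (length-map (outside ∷_) (subsetsMeeting u zero r)) (length-subsetsMeeting u zero r)
length-subsetsMeeting (inside ∷ u)  (suc i) r       = begin
  length (map (outside ∷_) A ++ map (inside ∷_) B)
    ≡⟨ length-map-++-map A B ⟩
  length A + length B
    ≡⟨ cong₂ _+_ (length-subsetsMeeting u (suc i) r) (length-subsetsMeeting u i r) ⟩
  (∣ u ∣ C suc i) * X + (∣ u ∣ C i) * X
    ≡⟨ sym (*-distribʳ-+ X (∣ u ∣ C suc i) _) ⟩
  (∣ u ∣ C suc i + ∣ u ∣ C i) * X
    ≡⟨ cong (_* X) (trans (+-comm (∣ u ∣ C suc i) _) (nCk+nC[k+1]≡[n+1]C[k+1] ∣ u ∣ i)) ⟩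
  (suc ∣ u ∣ C suc i) * X
    ∎
  where
  open ≡-Reasoning
  A = subsetsMeeting u (suc i) r
  B = subsetsMeeting u i r
  X = ∣ ∁ u ∣ C r
length-subsetsMeeting (outside ∷ u) i       zero    =
  trans (length-map (outside ∷_) (subsetsMeeting u i zero)) (length-subsetsMeeting u i zero)
length-subsetsMeeting (outside ∷ u) i       (suc r) = begin
  length (map (outside ∷_) A ++ map (inside ∷_) B)
    ≡⟨ length-map-++-map A B ⟩
  length A + length B
    ≡⟨ cong₂ _+_ (length-subsetsMeeting u i (suc r)) (length-subsetsMeeting u i r) ⟩
  Y * (∣ ∁ u ∣ C suc r) + Y * (∣ ∁ u ∣ C r)
    ≡⟨ sym (*-distribˡ-+ Y (∣ ∁ u ∣ C suc r) _) ⟩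
  Y * (∣ ∁ u ∣ C suc r + ∣ ∁ u ∣ C r)
    ≡⟨ cong (Y *_) (trans (+-comm (∣ ∁ u ∣ C suc r) _) (nCk+nC[k+1]≡[n+1]C[k+1] ∣ ∁ u ∣ r)) ⟩
  Y * (suc ∣ ∁ u ∣ C suc r)
    ∎
  where
  open ≡-Reasoning
  A = subsetsMeeting u i (suc r)
  B = subsetsMeeting u i r
  Y = ∣ u ∣ C i

concatUpTo : {A : Set} → ℕ → (ℕ → List A) → List A
concatUpTo zero    L = L 0
concatUpTo (suc h) L = concatUpTo h L ++ L (suc h)

length-concatUpTo≤sumTo : {A : Set} (h : ℕ) (L : ℕ → List A) {f : ℕ → ℕ} →
  (∀ j → length (L j) ≤ f j) → length (concatUpTo h L) ≤ sumTo h f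
length-concatUpTo≤sumTo zero    L ∣L∣≤f = ∣L∣≤f 0
length-concatUpTo≤sumTo (suc h) L ∣L∣≤f = ≤-trans (≤-reflexive (length-++ (concatUpTo h L)))
  (+-mono-≤ (length-concatUpTo≤sumTo h L ∣L∣≤f) (∣L∣≤f (suc h)))

∈-concatUpTo : {A : Set} {h j : ℕ} {L : ℕ → List A} {x : A} → j ≤ h → x ∈ L j → x ∈ concatUpTo h L
∈-concatUpTo {h = zero}          z≤n   x∈ = x∈
∈-concatUpTo {h = suc h} {L = L} j≤1+h x∈ with m≤n⇒m<n∨m≡n j≤1+h
... | inj₁ j<1+h = ∈-++⁺ˡ (∈-concatUpTo (s≤s⁻¹ j<1+h) x∈)
... | inj₂ refl  = ∈-++⁺ʳ (concatUpTo h L) x∈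

least-witness : {P : ℕ → Set} → Decidable P → ∀ {n} → P n → ∃[ m ] (P m × ∀ {k} → P k → m ≤ k)
least-witness {P} P? {n} pn = search 0 n (λ ()) pn
  where
  search : ∀ i f → (∀ {k} → k < i → ¬ P k) → P (i + f) → ∃[ m ] (P m × ∀ {k} → P k → m ≤ k)
  search i f below p with P? i
  ... | yes pi = i , pi , λ pk → ≮⇒≥ (λ k<i → below k<i pk)
  search i zero    below p | no ¬pi = contradiction (subst P (+-identityʳ i) p) ¬pi
  search i (suc f) below p | no ¬pi = search (suc i) f below′ (subst P (+-suc i f) p)
    where
    below′ : ∀ {k} → k < suc i → ¬ P k
    below′ k<1+i with m<1+n⇒m<n∨m≡n k<1+i
    ... | inj₁ k<i  = below k<i
    ... | inj₂ refl = ¬pi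

data Parity : ℕ → Set where
  even : ∀ t → Parity (2 * t)
  odd  : ∀ t → Parity (suc (2 * t))

parity : ∀ l → Parity l
parity zero    = even 0
parity (suc l) with parity l
... | even t = odd t
... | odd t  = subst Parity (*-suc 2 t) (even (suc t))

module _ {V : Set} {A : V → V → Set} where

  _++ʷ_ : ∀ {x y z a b} → Walk A x y a → Walk A y z b → Walk A x z (a + b)
  stop     ++ʷ q = q
  step e p ++ʷ q = step e (p ++ʷ q)

  _∷ʳʷ_ : ∀ {x y z l} → Walk A x y l → A y z → Walk A x z (suc l)
  stop     ∷ʳʷ e = step e stop
  step d p ∷ʳʷ e = step d (p ∷ʳʷ e)

  onWalk-∷ʳ : ∀ {w x y z l} (p : Walk A x y l) (e : A y z) → OnWalk w p → OnWalk w (p ∷ʳʷ e)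
  onWalk-∷ʳ p          e (start .p)   = start (p ∷ʳʷ e)
  onWalk-∷ʳ (step d p) e (later .d o) = later d (onWalk-∷ʳ p e o)

  onWalk-end : ∀ {x y l} (p : Walk A x y l) → OnWalk y p
  onWalk-end stop       = start stop
  onWalk-end (step e p) = later e (onWalk-end p)

module KneserDistance (N K : ℕ) where

  Vertex : Set
  Vertex = KVertex N K

  _~_ : Vertex → Vertex → Set
  _~_ = KAdj N K

  meet : Vertex → Vertex → ℕ
  meet x y = ∣ proj₁ x ∩ proj₁ y ∣

  meet-self : ∀ x → meet x x ≡ N
  meet-self (x , ∣x∣≡N) = trans (cong ∣_∣ (∩-idem x)) ∣x∣≡N

  meet≤N : ∀ x y → meet x y ≤ N
  meet≤N (x , ∣x∣≡N) (y , _) = subst (∣ x ∩ y ∣ ≤_) ∣x∣≡N (∣p∩q∣≤∣p∣ x y)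

  N≤meet⇒≡ : ∀ x y → N ≤ meet x y → x ≡ y
  N≤meet⇒≡ (x , ∣x∣≡N) (y , ∣y∣≡N) N≤∣x∩y∣
    with ∣p∣≤∣p∩q∣⇒∣q∣≤∣p∩q∣⇒p≡q x y (subst (_≤ ∣ x ∩ y ∣) (sym ∣x∣≡N) N≤∣x∩y∣)
                                     (subst (_≤ ∣ x ∩ y ∣) (sym ∣y∣≡N) N≤∣x∩y∣)
  ... | refl = cong (x ,_) (≡-irrelevant ∣x∣≡N ∣y∣≡N)

  ~-sym : ∀ {x y} → x ~ y → y ~ x
  ~-sym {x , _} {y , _} x∩y≡∅ = trans (∩-comm y x) x∩y≡∅

  ∣∁x∣≡N+K : ∀ x → ∣ ∁ (proj₁ x) ∣ ≡ N + K
  ∣∁x∣≡N+K (x , ∣x∣≡N) = +-cancelˡ-≡ N _ _ (begin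
    N + ∣ ∁ x ∣      ≡⟨ cong (_+ ∣ ∁ x ∣) (sym ∣x∣≡N) ⟩
    ∣ x ∣ + ∣ ∁ x ∣  ≡⟨ ∣p∣+∣∁p∣≡n x ⟩
    2 * N + K       ≡⟨ cong (λ a → N + a + K) (+-identityʳ N) ⟩
    N + N + K       ≡⟨ +-assoc N N K ⟩
    N + (N + K)     ∎)
    where open ≡-Reasoning

  meet+∣u∩∁x∣≡N : ∀ x u → meet u x + ∣ proj₁ u ∩ ∁ (proj₁ x) ∣ ≡ N
  meet+∣u∩∁x∣≡N x u = trans (∣p∩q∣+∣p∩∁q∣≡∣p∣ (proj₁ u) (proj₁ x)) (proj₂ u)

  ∣∁u∩∁x∣≡meet+K : ∀ x u → ∣ ∁ (proj₁ u) ∩ ∁ (proj₁ x) ∣ ≡ meet u x + K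
  ∣∁u∩∁x∣≡meet+K x u = +-cancelˡ-≡ ∣ u′ ∩ ∁ x′ ∣ _ _ (begin
    ∣ u′ ∩ ∁ x′ ∣ + ∣ ∁ u′ ∩ ∁ x′ ∣  ≡⟨ ∣p∩q∣+∣∁p∩q∣≡∣q∣ u′ (∁ x′) ⟩
    ∣ ∁ x′ ∣                        ≡⟨ ∣∁x∣≡N+K x ⟩
    N + K                          ≡⟨ cong (_+ K) (sym (meet+∣u∩∁x∣≡N x u)) ⟩
    meet u x + ∣ u′ ∩ ∁ x′ ∣ + K     ≡⟨ cong (_+ K) (+-comm (meet u x) _) ⟩
    ∣ u′ ∩ ∁ x′ ∣ + meet u x + K     ≡⟨ +-assoc _ (meet u x) K ⟩
    ∣ u′ ∩ ∁ x′ ∣ + (meet u x + K)   ∎)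
    where
    open ≡-Reasoning
    x′ = proj₁ x
    u′ = proj₁ u

  neighbour : (x u : Vertex) {s : ℕ} → N ≤ s + meet u x + K → s + meet u x ≤ N →
    ∃[ y ] (x ~ y × meet u y ≡ s)
  neighbour x u {s} N≤s+c+K s+c≤N =
    let S , x∩S≡∅ , ∣S∣≡s+[N∸s] , ∣u∩S∣≡s = subset-avoiding (proj₁ x) (proj₁ u) s≤∣u∩∁x∣ N∸s≤∣∁u∩∁x∣
    in (S , trans ∣S∣≡s+[N∸s] (m+[n∸m]≡n (≤-trans (m≤m+n s (meet u x)) s+c≤N))) , x∩S≡∅ , ∣u∩S∣≡s
    where
    s≤∣u∩∁x∣ : s ≤ ∣ proj₁ u ∩ ∁ (proj₁ x) ∣
    s≤∣u∩∁x∣ = +-cancelˡ-≤ (meet u x) _ _ (begin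
      meet u x + s                          ≡⟨ +-comm (meet u x) s ⟩
      s + meet u x                          ≤⟨ s+c≤N ⟩
      N                                     ≡⟨ sym (meet+∣u∩∁x∣≡N x u) ⟩
      meet u x + ∣ proj₁ u ∩ ∁ (proj₁ x) ∣  ∎)
      where open ≤-Reasoning
    N∸s≤∣∁u∩∁x∣ : N ∸ s ≤ ∣ ∁ (proj₁ u) ∩ ∁ (proj₁ x) ∣
    N∸s≤∣∁u∩∁x∣ = m≤n+o⇒m∸n≤o N s
      (subst (N ≤_) (trans (+-assoc s _ K) (cong (s ℕ.+_) (sym (∣∁u∩∁x∣≡meet+K x u)))) N≤s+c+K)

  approach : (x y : Vertex) → ∃[ z ] (Walk _~_ z y 2 × meet x z ≡ (meet x y + K) ⊓ N)
  approach x y =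
    let z₁ , y~z₁ , meet≡s₁ = neighbour y x {s₁} N≤s₁+c+K s₁+c≤N
        z₂ , z₁~z₂ , meet≡s₂ =
          neighbour z₁ x {s₂} (N≤s₂+meet+K {z₁} meet≡s₁) (≤-reflexive (s₂+meet≡N {z₁} meet≡s₁))
    in z₂ , step {y = z₁} (~-sym {z₁} {z₂} z₁~z₂) (step (~-sym {y} {z₁} y~z₁) stop) , meet≡s₂
    where
    c  = meet x y
    s₁ = N ∸ (c + K)
    s₂ = (c + K) ⊓ N
    N≤s₁+c+K : N ≤ s₁ + c + K
    N≤s₁+c+K = subst (N ≤_) (trans (+-comm (c + K) s₁) (sym (+-assoc s₁ c K))) (m≤n+m∸n N (c + K))
    s₁+c≤N : s₁ + c ≤ N
    s₁+c≤N = ≤-trans (+-monoˡ-≤ c (∸-monoʳ-≤ N (m≤m+n c K))) (≤-reflexive (m∸n+n≡m (meet≤N x y)))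
    s₂+meet≡N : ∀ {z} → meet x z ≡ s₁ → s₂ + meet x z ≡ N
    s₂+meet≡N meet≡s₁ = trans (cong (s₂ ℕ.+_) meet≡s₁) (m⊓n+n∸m≡n (c + K) N)
    N≤s₂+meet+K : ∀ {z} → meet x z ≡ s₁ → N ≤ s₂ + meet x z + K
    N≤s₂+meet+K {z} meet≡s₁ = subst (λ a → N ≤ a + K) (sym (s₂+meet≡N {z} meet≡s₁)) (m≤m+n N K)

  even-walk : ∀ t x y → N ≤ meet x y + t * K → Walk _~_ x y (2 * t)
  even-walk zero    x y N≤meet+0 =
    subst (λ v → Walk _~_ x v 0) (N≤meet⇒≡ x y (subst (N ≤_) (+-identityʳ _) N≤meet+0)) stop
  even-walk (suc t) x y N≤meet+[1+t]K =
    let z , z⇝y , meet≡ = approach x y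
    in subst (Walk _~_ x y) (trans (+-comm (2 * t) 2) (sym (*-suc 2 t)))
         (even-walk t x z (N≤meet+tK {z} meet≡) ++ʷ z⇝y)
    where
    N≤meet+tK : ∀ {z} → meet x z ≡ (meet x y + K) ⊓ N → N ≤ meet x z + t * K
    N≤meet+tK meet≡ =
      subst (N ≤_) (sym (trans (cong (_+ t * K) meet≡) (+-distribʳ-⊓ (t * K) (meet x y + K) N)))
        (⊓-glb (subst (N ≤_) (sym (+-assoc (meet x y) K (t * K))) N≤meet+[1+t]K) (m≤m+n N (t * K)))

  odd-walk : ∀ t x y → meet x y ≤ t * K → Walk _~_ x y (suc (2 * t))
  odd-walk t x y meet≤tK =
    let z , y~z , meet≡N∸c = neighbour y x {N ∸ meet x y} N≤s+c+K (≤-reflexive N∸c+c≡N)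
    in even-walk t x z (N≤meet+tK {z} meet≡N∸c) ∷ʳʷ ~-sym {y} {z} y~z
    where
    N∸c+c≡N : N ∸ meet x y + meet x y ≡ N
    N∸c+c≡N = m∸n+n≡m (meet≤N x y)
    N≤s+c+K : N ≤ N ∸ meet x y + meet x y + K
    N≤s+c+K = subst (λ a → N ≤ a + K) (sym N∸c+c≡N) (m≤m+n N K)
    N≤meet+tK : ∀ {z} → meet x z ≡ N ∸ meet x y → N ≤ meet x z + t * K
    N≤meet+tK {z} meet≡N∸c = begin
      N                        ≡⟨ sym N∸c+c≡N ⟩
      N ∸ meet x y + meet x y  ≤⟨ +-monoʳ-≤ (N ∸ meet x y) meet≤tK ⟩
      N ∸ meet x y + t * K     ≡⟨ cong (_+ t * K) (sym meet≡N∸c) ⟩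
      meet x z + t * K         ∎
      where open ≤-Reasoning

  data Reach (s : ℕ) : ℕ → Set where
    even : ∀ t → N ≤ s + t * K → Reach s (2 * t)
    odd  : ∀ t → s ≤ t * K → Reach s (suc (2 * t))

  reach⇒walk : ∀ {x y l} → Reach (meet x y) l → Walk _~_ x y l
  reach⇒walk (even t N≤meet+tK) = even-walk t _ _ N≤meet+tK
  reach⇒walk (odd t meet≤tK)    = odd-walk t _ _ meet≤tK

  ~-reach : ∀ {x y z l} → x ~ y → Reach (meet y z) l → Reach (meet x z) (suc l)
  ~-reach {x} {y} {z} x~y (even t N≤meet+tK) = odd t (+-cancelʳ-≤ (meet y z) _ _ (begin
    meet x z + meet y z  ≤⟨ p∩q≡∅⇒∣p∩r∣+∣q∩r∣≤∣r∣ (proj₁ x) (proj₁ y) (proj₁ z) x~y ⟩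
    ∣ proj₁ z ∣          ≡⟨ proj₂ z ⟩
    N                    ≤⟨ N≤meet+tK ⟩
    meet y z + t * K     ≡⟨ +-comm (meet y z) (t * K) ⟩
    t * K + meet y z     ∎))
    where open ≤-Reasoning
  ~-reach {x} {y} {z} x~y (odd t meet≤tK) =
    subst (Reach _) (*-suc 2 t) (even (suc t) (+-cancelˡ-≤ N _ _ (begin
      N + N                                  ≡⟨ sym (cong₂ _+_ (proj₂ x) (proj₂ y)) ⟩
      ∣ proj₁ x ∣ + ∣ proj₁ y ∣              ≤⟨ p∩q≡∅⇒∣p∣+∣q∣≤∣p∩r∣+∣q∩r∣+∣∁r∣ (proj₁ x) (proj₁ y) (proj₁ z) x~y ⟩
      meet x z + meet y z + ∣ ∁ (proj₁ z) ∣  ≡⟨ cong (meet x z + meet y z ℕ.+_) (∣∁x∣≡N+K z) ⟩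
      meet x z + meet y z + (N + K)          ≤⟨ +-monoˡ-≤ (N + K) (+-monoʳ-≤ (meet x z) meet≤tK) ⟩
      meet x z + t * K + (N + K)             ≡⟨ regroup (meet x z) (t * K) N K ⟩
      N + (meet x z + (K + t * K))           ∎)))
    where
    open ≤-Reasoning
    regroup : ∀ a b n k → a + b + (n + k) ≡ n + (a + (k + b))
    regroup = solve-∀

  walk⇒reach : ∀ {x y l} → Walk _~_ x y l → Reach (meet x y) l
  walk⇒reach {x}     stop               =
    even 0 (subst (N ≤_) (sym (trans (+-identityʳ _) (meet-self x))) ≤-refl)
  walk⇒reach {x} {z} (step {y = y} e p) = ~-reach {x} {y} {z} e (walk⇒reach p)

  reach-even⁻¹ : ∀ {s t} → Reach s (2 * t) → N ≤ s + t * K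
  reach-even⁻¹ {s} {t} r = invert r refl
    where
    invert : ∀ {l} → Reach s l → l ≡ 2 * t → N ≤ s + t * K
    invert (even t′ h) e = subst (λ a → N ≤ s + a * K) (*-cancelˡ-≡ t′ t 2 e) h
    invert (odd t′ _)  e = contradiction (sym e) (even≢odd t t′)

  reach-odd⁻¹ : ∀ {s t} → Reach s (suc (2 * t)) → s ≤ t * K
  reach-odd⁻¹ {s} {t} r = invert r refl
    where
    invert : ∀ {l} → Reach s l → l ≡ suc (2 * t) → s ≤ t * K
    invert (even t′ _) e = contradiction e (even≢odd t′ t)
    invert (odd t′ h)  e = subst (λ a → s ≤ a * K) (*-cancelˡ-≡ t′ t 2 (suc-injective e)) h

  reach? : ∀ s → Decidable (Reach s)
  reach? s l with parity l
  ... | even t = Dec.map′ (even t) (reach-even⁻¹ {t = t}) (N ≤? s + t * K)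
  ... | odd t  = Dec.map′ (odd t) (reach-odd⁻¹ {t = t}) (s ≤? t * K)

  Dist : ℕ → ℕ → Set
  Dist s l = Reach s l × (∀ {l′} → Reach s l′ → l ≤ l′)

  dist⇒shortest : ∀ {x y l} → Dist (meet x y) l → Shortest _~_ x y l
  dist⇒shortest (_ , least) _ p = least (walk⇒reach p)

  module _ .{{_ : NonZero K}} where

    reach-diameter : ∀ s → Reach s (2 * N)
    reach-diameter s = even N (≤-trans (m≤m*n N K) (m≤n+m (N * K) s))

    dist : ∀ s → ∃[ l ] Dist s l
    dist s = least-witness (reach? s) (reach-diameter s)

    dist≤diameter : ∀ {s l} → Dist s l → l ≤ 2 * N
    dist≤diameter {s} (_ , least) = least (reach-diameter s)

ceilDiv-≡ : ∀ {q m} d .{{_ : NonZero d}} → q * d < m → m ≤ q * d + d → ceilDiv m d ≡ suc q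
ceilDiv-≡ {q} (suc d′) qd<m m≤qd+d with m≤n⇒∃[o]m+o≡n qd<m
... | r , refl = begin
  (suc (q * d) + r + d′) / d  ≡⟨ /-congˡ (regroup q d′ r) ⟩
  (r + suc q * d) / d         ≡⟨ +-distrib-/-∣ʳ r (n∣m*n (suc q)) ⟩
  r / d + suc q * d / d       ≡⟨ cong₂ _+_ (m<n⇒m/n≡0 r<d) (m*n/n≡m (suc q) d) ⟩
  suc q                       ∎
  where
  open ≡-Reasoning
  d = suc d′
  regroup : ∀ q d′ r → suc (q * suc d′) + r + d′ ≡ r + suc q * suc d′
  regroup = solve-∀
  r<d : r < d
  r<d = +-cancelˡ-≤ (q * d) (suc r) d (subst (_≤ q * d + d) (sym (+-suc (q * d) r)) m≤qd+d)

-- H N K unfolds to H′ K (N % K).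
H′ : ℕ → ℕ → ℕ
H′ K ρ = if ρ ≤ᵇ 1 then ρ + K ∸ 2 else ρ ∸ 2

H′[r%K]≡r∸2 : ∀ K .{{_ : NonZero K}} r → 2 ≤ r → r ≤ suc K → H′ K (r % K) ≡ r ∸ 2
H′[r%K]≡r∸2 K (suc zero)     (s≤s ()) _
H′[r%K]≡r∸2 K (suc (suc r′)) _        r≤1+K with m≤n⇒m<n∨m≡n r≤1+K
... | inj₁ (s≤s r≤K) with m≤n⇒m<n∨m≡n r≤K
...   | inj₁ r<K  = cong (H′ K) (m<n⇒m%n≡m r<K)
...   | inj₂ refl = cong (H′ K) (n%n≡0 K)
H′[r%K]≡r∸2 (suc zero)      (suc (suc r′)) _ _ | inj₂ refl = refl
H′[r%K]≡r∸2 K@(suc (suc k)) (suc (suc r′)) _ _ | inj₂ refl = cong (H′ K) (begin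
  suc K % K        ≡⟨ cong (λ a → suc a % K) (sym (*-identityˡ K)) ⟩
  (1 + 1 * K) % K  ≡⟨ [m+kn]%n≡m%n 1 1 K ⟩
  1 % K            ≡⟨ m<n⇒m%n≡m (s≤s (s≤s z≤n)) ⟩
  1                ∎)
  where open ≡-Reasoning

H-≡ : ∀ K .{{_ : NonZero K}} e r → 2 ≤ r → r ≤ suc K → H (r + e * K) K ≡ r ∸ 2
H-≡ K e r 2≤r r≤1+K = trans (cong (H′ K) ([m+kn]%n≡m%n r e K)) (H′[r%K]≡r∸2 K r 2≤r r≤1+K)

pVal-≡ : ∀ N K .{{_ : NonZero K}} q → q * (2 * K) < N ∸ 1 → N ∸ 1 ≤ q * (2 * K) + 2 * K →
  pVal N K ≡ + suc (q * K)
pVal-≡ N K q lo hi = begin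
  pVal N K             ≡⟨ cong (λ c → (+ c ℤ.- + 1) ℤ.* + K ℤ.+ + 1) (ceilDiv-≡ {q} (2 * K) {{m*n≢0 2 K}} lo hi) ⟩
  + q ℤ.* + K ℤ.+ + 1  ≡⟨ cong (ℤ._+ + 1) (sym (pos-* q K)) ⟩
  + (q * K + 1)        ≡⟨ cong +_ (+-comm (q * K) 1) ⟩
  + suc (q * K)        ∎
  where open ≡-Reasoning

InRange : (N K : ℕ) .{{_ : NonZero K}} → ℕ → Set
InRange N K s = ∃[ j ] (j ≤ H N K × pVal N K ℤ.+ + j ≡ + s)

-- For N = 1 the range [p, p + H] is [1 - K, 0].
0∈range[1] : ∀ K .{{_ : NonZero K}} → InRange 1 K 0
0∈range[1] (suc zero)    = 0 , z≤n , refl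
0∈range[1] (suc (suc k)) = suc k , ≤-refl , p+k≡0
  where
  open ≡-Reasoning
  K = suc (suc k)
  cancel : ∀ x → (ℤ.- + 1) ℤ.* (+ 2 ℤ.+ x) ℤ.+ + 1 ℤ.+ (+ 1 ℤ.+ x) ≡ + 0
  cancel = ℤ-solve-∀
  p+k≡0 : pVal 1 K ℤ.+ + suc k ≡ + 0
  p+k≡0 = begin
    pVal 1 K ℤ.+ + suc k
      ≡⟨ cong (λ c → (+ c ℤ.- + 1) ℤ.* + K ℤ.+ + 1 ℤ.+ + suc k) (m<n⇒m/n≡0 (n<1+n (2 * K ∸ 1))) ⟩
    (ℤ.- + 1) ℤ.* (+ 2 ℤ.+ + k) ℤ.+ + 1 ℤ.+ (+ 1 ℤ.+ + k)
      ≡⟨ cancel (+ k) ⟩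
    + 0
      ∎

-- These conditions force ⌈(N − 1)/(2K)⌉ = t + 1, i.e. p = tK + 1, and N = r + (t + a)K
-- with s − p + 2 ≤ r ≤ K + 1, where H = r − 2.
in-range : ∀ N K .{{_ : NonZero K}} {s} t a → t ≤ a → a ≤ suc t → t * K < s → s + a * K < N →
  N ≤ (t + a) * K + suc K → InRange N K s
in-range (suc n) K {s} t a t≤a a≤1+t tK<s s+aK<N N≤ with m≤n⇒∃[o]m+o≡n tK<s
... | j , refl = j , j≤H , cong (ℤ._+ + j) (pVal-≡ (suc n) K t lo hi)
  where
  lo : t * (2 * K) < n
  lo = begin-strict
    t * (2 * K)              ≡⟨ *-distribˡ-+ t K (K + 0) ⟩
    t * K + t * (K + 0)      ≡⟨ cong (λ b → t * K + t * b) (+-identityʳ K) ⟩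
    t * K + t * K            ≤⟨ +-monoʳ-≤ (t * K) (*-monoˡ-≤ K t≤a) ⟩
    t * K + a * K            <⟨ s≤s (+-monoˡ-≤ (a * K) (m≤m+n (t * K) j)) ⟩
    suc (t * K) + j + a * K  ≤⟨ s≤s⁻¹ s+aK<N ⟩
    n                        ∎
    where open ≤-Reasoning
  hi : n ≤ t * (2 * K) + 2 * K
  hi = begin
    n                    ≤⟨ s≤s⁻¹ (subst (suc n ≤_) (+-suc _ K) N≤) ⟩
    (t + a) * K + K      ≤⟨ +-monoˡ-≤ K (*-monoˡ-≤ K (+-monoʳ-≤ t a≤1+t)) ⟩
    (t + suc t) * K + K  ≡⟨ regroup t K ⟩
    t * (2 * K) + 2 * K  ∎
    where
    open ≤-Reasoning
    regroup : ∀ t K → (t + suc t) * K + K ≡ t * (2 * K) + 2 * K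
    regroup = solve-∀
  eK+[j+2]≤N : (t + a) * K + (j + 2) ≤ suc n
  eK+[j+2]≤N = subst (_≤ suc n) (regroup t a K j) s+aK<N
    where
    regroup : ∀ t a K j → suc (suc (t * K) + j + a * K) ≡ (t + a) * K + (j + 2)
    regroup = solve-∀
  j≤H : j ≤ H (suc n) K
  j≤H with m≤n⇒∃[o]m+o≡n (≤-trans (m≤m+n ((t + a) * K) (j + 2)) eK+[j+2]≤N)
  ... | r , eK+r≡N = subst (j ≤_) (sym H≡r∸2) (m+n≤o⇒m≤o∸n j j+2≤r)
    where
    j+2≤r : j + 2 ≤ r
    j+2≤r = +-cancelˡ-≤ ((t + a) * K) _ _ (subst ((t + a) * K + (j + 2) ≤_) (sym eK+r≡N) eK+[j+2]≤N)
    r≤1+K : r ≤ suc K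
    r≤1+K = +-cancelˡ-≤ ((t + a) * K) _ _ (subst (_≤ (t + a) * K + suc K) (sym eK+r≡N) N≤)
    H≡r∸2 : H (suc n) K ≡ r ∸ 2
    H≡r∸2 = trans (cong (λ m → H m K) (trans (sym eK+r≡N) (+-comm ((t + a) * K) r)))
                  (H-≡ K (t + a) r (≤-trans (m≤n+m 2 j) j+2≤r) r≤1+K)

module GeodeticSet (n k : ℕ) where

  N K : ℕ
  N = suc n
  K = suc k

  open KneserDistance N K public

  Extends : ℕ → ℕ → Set
  Extends s l = ∃[ s′ ] (N ≤ s′ + s + K × s′ + s ≤ N × Dist s′ (suc l))

  unreachable : ∀ {s l l′} → Dist s l → l′ < l → ¬ Reach s l′
  unreachable (_ , least) l′<l r = <⇒≱ l′<l (least r)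

  unreachable-even : ∀ {s l} t → Dist s l → 2 * t < l → s + t * K < N
  unreachable-even t d 2t<l = ≰⇒> (unreachable d 2t<l ∘ even t)

  unreachable-odd : ∀ {s l} t → Dist s l → suc (2 * t) < l → t * K < s
  unreachable-odd t d 1+2t<l = ≰⇒> (unreachable d 1+2t<l ∘ odd t)

  dist-from-gaps : ∀ {s l} u v → Reach s l → s + u * K < N → v * K < s →
    l ≤ 2 * suc u → l ≤ suc (2 * suc v) → Dist s l
  dist-from-gaps {s} {l} u v r s+uK<N vK<s l≤2[1+u] l≤1+2[1+v] = r , least
    where
    least : ∀ {l′} → Reach s l′ → l ≤ l′
    least (even j N≤s+jK) = ≤-trans l≤2[1+u]
      (*-monoʳ-≤ 2 (*-cancelʳ-< K u j (+-cancelˡ-< s _ _ (<-≤-trans s+uK<N N≤s+jK))))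
    least (odd j s≤jK)    = ≤-trans l≤1+2[1+v]
      (s≤s (*-monoʳ-≤ 2 (*-cancelʳ-< K v j (<-≤-trans vK<s s≤jK))))

  2t<2[1+t] : ∀ t → 2 * t < 2 * suc t
  2t<2[1+t] t = *-monoʳ-< 2 (n<1+n t)

  1+2t<2[1+t] : ∀ t → suc (2 * t) < 2 * suc t
  1+2t<2[1+t] t = ≤-reflexive (sym (*-suc 2 t))

  dist-0-1 : Dist 0 1
  dist-0-1 = odd 0 z≤n , λ { (even zero ()) ; (even (suc _) _) → s≤s z≤n ; (odd _ _) → s≤s z≤n }

  odd-extends : ∀ {s} t → s ≤ t * K → Dist s (suc (2 * t)) → suc (t * K + t * K) < N →
    Extends s (suc (2 * t))
  odd-extends {s} t s≤tK d 2tK+1<N = s′ , N≤s′+s+K , s′+s≤N ,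
    dist-from-gaps t t reach′ (≤-reflexive (trans (sym (+-suc s′ (t * K))) s′+1+tK≡N)) tK<s′
      (≤-reflexive (sym (*-suc 2 t))) (≤-trans (≤-reflexive (sym (*-suc 2 t))) (n≤1+n _))
    where
    s′ = N ∸ suc (t * K)
    s′+1+tK≡N : s′ + suc (t * K) ≡ N
    s′+1+tK≡N = m∸n+n≡m (≤-trans (s≤s (m≤m+n (t * K) (t * K))) (<⇒≤ 2tK+1<N))
    1+tK≤s+K : ∀ t → Dist s (suc (2 * t)) → suc (t * K) ≤ s + K
    1+tK≤s+K zero     _ = ≤-trans (s≤s z≤n) (m≤n+m K s)
    1+tK≤s+K (suc t₀) d = subst (_≤ s + K) (cong suc (+-comm (t₀ * K) K))
      (+-monoˡ-≤ K (unreachable-odd t₀ d (s≤s (2t<2[1+t] t₀))))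
    N≤s′+s+K : N ≤ s′ + s + K
    N≤s′+s+K = begin
      N                 ≡⟨ sym s′+1+tK≡N ⟩
      s′ + suc (t * K)  ≤⟨ +-monoʳ-≤ s′ (1+tK≤s+K t d) ⟩
      s′ + (s + K)      ≡⟨ sym (+-assoc s′ s K) ⟩
      s′ + s + K        ∎
      where open ≤-Reasoning
    s′+s≤N : s′ + s ≤ N
    s′+s≤N = ≤-trans (+-monoʳ-≤ s′ (m≤n⇒m≤1+n s≤tK)) (≤-reflexive s′+1+tK≡N)
    reach′ : Reach s′ (suc (suc (2 * t)))
    reach′ = subst (Reach s′) (*-suc 2 t) (even (suc t) (begin
      N                 ≡⟨ sym s′+1+tK≡N ⟩
      s′ + suc (t * K)  ≤⟨ +-monoʳ-≤ s′ (s≤s (m≤n+m (t * K) k)) ⟩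
      s′ + suc t * K    ∎))
      where open ≤-Reasoning
    tK<s′ : t * K < s′
    tK<s′ = +-cancelʳ-≤ (suc (t * K)) (suc (t * K)) s′ (begin
      suc (t * K) + suc (t * K)  ≡⟨ cong suc (+-suc (t * K) (t * K)) ⟩
      suc (suc (t * K + t * K))  ≤⟨ 2tK+1<N ⟩
      N                          ≡⟨ sym s′+1+tK≡N ⟩
      s′ + suc (t * K)           ∎)
      where open ≤-Reasoning

  odd-in-range : ∀ {s} t → s ≤ t * K → Dist s (suc (2 * t)) → N ≤ suc (t * K + t * K) → InRange N K s
  odd-in-range zero     s≤0 _ N≤1 =
    subst₂ (λ a b → InRange (suc a) K b) (sym (n≤0⇒n≡0 (s≤s⁻¹ N≤1))) (sym (n≤0⇒n≡0 s≤0)) (0∈range[1] K)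
  odd-in-range (suc t₀) _   d N≤  = in-range N K t₀ (suc t₀) (n≤1+n t₀) ≤-refl
    (unreachable-odd t₀ d (s≤s (2t<2[1+t] t₀))) (unreachable-even (suc t₀) d ≤-refl)
    (subst (N ≤_) (regroup t₀ K) N≤)
    where
    regroup : ∀ t₀ K → suc (suc t₀ * K + suc t₀ * K) ≡ (t₀ + suc t₀) * K + suc K
    regroup = solve-∀

  odd-step : ∀ {s} t → s ≤ t * K → Dist s (suc (2 * t)) → InRange N K s ⊎ Extends s (suc (2 * t))
  odd-step t s≤tK d with suc (t * K + t * K) <? N
  ... | yes 2tK+1<N = inj₂ (odd-extends t s≤tK d 2tK+1<N)
  ... | no 2tK+1≮N  = inj₁ (odd-in-range t s≤tK d (≮⇒≥ 2tK+1≮N))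

  even-step : ∀ {s} t → s ≤ N → N ≤ s + t * K → Dist s (2 * t) → InRange N K s ⊎ Extends s (2 * t)
  even-step {s} zero     s≤N N≤s+0 _ = inj₂ (0 , ≤-trans N≤s+0 (+-monoʳ-≤ s z≤n) , s≤N , dist-0-1)
  even-step {s} (suc t₀) _   N≤    d with suc (t₀ * K) + suc t₀ * K <? N
  ... | yes s′+[1+t₀]K<N = inj₂ (suc (t₀ * K) , N≤s′+s+K , s′+s≤N ,
          dist-from-gaps (suc t₀) t₀ (odd (suc t₀) (s≤s (m≤n+m (t₀ * K) k))) s′+[1+t₀]K<N (n<1+n (t₀ * K))
            (2t<2[1+t] (suc t₀)) ≤-refl)
    where
    N≤s′+s+K : N ≤ suc (t₀ * K) + s + K
    N≤s′+s+K = ≤-trans N≤ (≤-trans (n≤1+n _) (≤-reflexive (regroup s K (t₀ * K))))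
      where
      regroup : ∀ s K a → suc (s + (K + a)) ≡ suc a + s + K
      regroup = solve-∀
    s′+s≤N : suc (t₀ * K) + s ≤ N
    s′+s≤N = subst (_≤ N) (cong suc (+-comm s (t₀ * K))) (unreachable-even t₀ d (2t<2[1+t] t₀))
  ... | no s′+[1+t₀]K≮N = inj₁ (in-range N K t₀ t₀ ≤-refl (n≤1+n t₀)
          (unreachable-odd t₀ d (1+2t<2[1+t] t₀)) (unreachable-even t₀ d (2t<2[1+t] t₀))
          (subst (N ≤_) (regroup t₀ K) (≮⇒≥ s′+[1+t₀]K≮N)))
    where
    regroup : ∀ t₀ K → suc (t₀ * K) + suc t₀ * K ≡ (t₀ + t₀) * K + suc K
    regroup = solve-∀

  in-range-or-extends : ∀ {s l} → s ≤ N → Dist s l → InRange N K s ⊎ Extends s l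
  in-range-or-extends s≤N d@(even t N≤s+tK , _) = even-step t s≤N N≤s+tK d
  in-range-or-extends _   d@(odd t s≤tK , _)    = odd-step t s≤tK d

  toVertex : Subset (2 * N + K) → Maybe Vertex
  toVertex S with ∣ S ∣ ≟ N
  ... | yes ∣S∣≡N = just (S , ∣S∣≡N)
  ... | no _      = nothing

  toVertex-proj₁ : ∀ v → toVertex (proj₁ v) ≡ just v
  toVertex-proj₁ (S , ∣S∣≡N) with ∣ S ∣ ≟ N
  ... | yes e = cong (λ e → just (S , e)) (≡-irrelevant e ∣S∣≡N)
  ... | no ¬e = contradiction ∣S∣≡N ¬e

  module _ (u₀ : Vertex) where

    OnGeodesicToRange : Vertex → Set
    OnGeodesicToRange w = ∃[ v ] (InRange N K (meet u₀ v) × InInterval _~_ u₀ v w)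

    -- The fuel cannot run out: each extension lengthens the geodesic, and distances are at most 2N.
    extend-geodesic : ∀ {w} fuel {x l} → 2 * N < l + fuel → Dist (meet u₀ x) l →
      (P : Walk _~_ u₀ x l) → OnWalk w P → OnGeodesicToRange w
    extend-geodesic fuel {x} {l} bound d P w∈P with in-range-or-extends (meet≤N u₀ x) d
    ... | inj₁ s∈range = x , s∈range , l , P , dist⇒shortest d , w∈P
    extend-geodesic zero           bound d P w∈P | inj₂ _ =
      contradiction (dist≤diameter d) (<⇒≱ (subst (2 * N <_) (+-identityʳ _) bound))
    extend-geodesic (suc fuel) {x} {l} bound d P w∈P | inj₂ (s′ , N≤s′+s+K , s′+s≤N , d′) =
      let y , x~y , meet≡s′ = neighbour x u₀ N≤s′+s+K s′+s≤N
      in extend-geodesic fuel {y} (subst (2 * N <_) (+-suc l fuel) bound)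
           (subst (λ s → Dist s (suc l)) (sym meet≡s′) d′) (P ∷ʳʷ x~y) (onWalk-∷ʳ P x~y w∈P)

    on-geodesic-to-range : ∀ w → OnGeodesicToRange w
    on-geodesic-to-range w =
      let l , d = dist (meet u₀ w)
      in extend-geodesic (suc (2 * N)) (m≤n+m _ l) d (reach⇒walk (proj₁ d)) (onWalk-end _)

    layer : ℤ → List Vertex
    layer (+ i)    = mapMaybe toVertex (subsetsMeeting (proj₁ u₀) i (N ∸ i))
    layer -[1+ _ ] = List.[]

    ∈-layer : ∀ v → v ∈ layer (+ meet u₀ v)
    ∈-layer v = Any.mapMaybe⁺ toVertex _ (Any.map⁺ (Any.map found v∈subsets))
      where
      ∣∁u₀∩v∣≡N∸meet : ∣ ∁ (proj₁ u₀) ∩ proj₁ v ∣ ≡ N ∸ meet u₀ v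
      ∣∁u₀∩v∣≡N∸meet = trans (sym (m+n∸m≡n (meet u₀ v) _))
        (cong (_∸ meet u₀ v) (trans (∣p∩q∣+∣∁p∩q∣≡∣q∣ (proj₁ u₀) (proj₁ v)) (proj₂ v)))
      v∈subsets : proj₁ v ∈ subsetsMeeting (proj₁ u₀) (meet u₀ v) (N ∸ meet u₀ v)
      v∈subsets = subst (λ r → proj₁ v ∈ subsetsMeeting (proj₁ u₀) (meet u₀ v) r) ∣∁u₀∩v∣≡N∸meet
        (∈-subsetsMeeting (proj₁ u₀) (proj₁ v))
      found : ∀ {S} → proj₁ v ≡ S → Maybe.Any (v ≡_) (toVertex S)
      found refl = subst (Maybe.Any (v ≡_)) (sym (toVertex-proj₁ v)) (Maybe.just refl)

    length-layer : ∀ z → length (layer z) ≤ binomℤ N z * binomℤ (N + K) (+ N ℤ.- z)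
    length-layer -[1+ _ ] = z≤n
    length-layer (+ i)    = begin
      length (mapMaybe toVertex (subsetsMeeting (proj₁ u₀) i (N ∸ i)))
        ≤⟨ length-mapMaybe toVertex (subsetsMeeting (proj₁ u₀) i (N ∸ i)) ⟩
      length (subsetsMeeting (proj₁ u₀) i (N ∸ i))
        ≡⟨ length-subsetsMeeting (proj₁ u₀) i (N ∸ i) ⟩
      (∣ proj₁ u₀ ∣ C i) * (∣ ∁ (proj₁ u₀) ∣ C (N ∸ i))
        ≡⟨ cong₂ (λ a b → (a C i) * (b C (N ∸ i))) (proj₂ u₀) (∣∁x∣≡N+K u₀) ⟩
      (N C i) * ((N + K) C (N ∸ i))
        ≤⟨ binom-N∸i ⟩
      (N C i) * binomℤ (N + K) (+ N ℤ.- + i)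
        ∎
      where
      open ≤-Reasoning
      binom-N∸i : (N C i) * ((N + K) C (N ∸ i)) ≤ (N C i) * binomℤ (N + K) (+ N ℤ.- + i)
      binom-N∸i with i ℕ.≤? N
      ... | yes i≤N = ≤-reflexive (cong (λ z → (N C i) * binomℤ (N + K) z)
                        (sym (trans ([+m]-[+n]≡m⊖n N i) (⊖-≥ i≤N))))
      ... | no i≰N  = subst (λ c → c * ((N + K) C (N ∸ i)) ≤ c * binomℤ (N + K) (+ N ℤ.- + i))
                        (sym (k>n⇒nCk≡0 (≰⇒> i≰N))) z≤n

    W : List Vertex
    W = u₀ List.∷ concatUpTo (H N K) (λ j → layer (pVal N K ℤ.+ + j))

    length-W : length W ≤ bound N K
    length-W = s≤s (length-concatUpTo≤sumTo (H N K) _ (λ j → length-layer (pVal N K ℤ.+ + j)))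

    W-geodetic : Geodetic _~_ W
    W-geodetic w =
      let v , (j , j≤H , p+j≡meet) , w∈I[u₀,v] = on-geodesic-to-range w
          v∈layer = subst (λ z → v ∈ layer z) (sym p+j≡meet) (∈-layer v)
      in u₀ , v , here refl , there (∈-concatUpTo j≤H v∈layer) , w∈I[u₀,v]

corollary5 : (n k : ℕ) →
    Σ (List (KVertex (suc n) (suc k))) (λ W →
    Geodetic (KAdj (suc n) (suc k)) W × length W ≤ bound (suc n) (suc k))
corollary5 n k = W u₀ , W-geodetic u₀ , length-W u₀
  where
  open GeodeticSet n k
  u₀ : Vertex
  u₀ = subset-of-size (2 * N + K) (≤-trans (m≤m+n N (N + 0)) (m≤m+n (2 * N) K))
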